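{- Let $d\ge 1$ and $n\ge 1$ be integers. For every connected layer multicomplex $M$ of rank $d$ on $n$ elements there exist positive integers $n_1,\dots,n_k$ with $\sum_{i=1}^k n_i\le 2n-1$ such that the length of $M$ is at most \[ H_{\mathrm{c.l.m.}}(n_1,d-1)+\dots+H_{\mathrm{c.l.m.}}(n_k,d-1)+k-1. \]
   Context: A pure multicomplex of rank $d$ on an $n$-element set $V$ is a nonempty collection $M$ of multisets of size $d$ of elements of $V$ (its facets); multiset containment is taken with multiplicities. A connected layer multicomplex (c.l.m.) is such an $M$ together with a partition $M=L_a\sqcup L_{a+1}\sqcup\dots\sqcup L_b$ ($a\le b$ integers) of its facets into nonempty layers such that for every multiset $S$, the set of indices $i$ for which $L_i$ contains a facet containing $S$ is an interval of integers. Its length is $b-a$. $H_{\mathrm{c.l.m.}}(n,d)$ is the maximum length of c.l.m.'s of rank $d$ on an $n$-element set (not all elements need to be used); for rank $0$ the only multicomplex is $\{\emptyset\}$. -}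

module Defs where

open import Data.Nat using (ℕ; suc; _≤_)
open import Data.Fin using (Fin; _≤_)
open import Data.Vec using (Vec; sum; lookup)
open import Data.List using (List)
open import Data.List.Membership.Propositional using (_∈_)
open import Data.List.Relation.Unary.Any using (Any)
open import Data.Product using (Σ; _×_; ∃)
open import Relation.Binary.PropositionalEquality using (_≡_)

Multiset : ℕ → Set
Multiset n = Vec ℕ n

size : ∀ {n} → Multiset n → ℕ
size = sum

_⊆ₘ_ : ∀ {n} → Multiset n → Multiset n → Set
S ⊆ₘ F = ∀ i → lookup S i Data.Nat.≤ lookup F i

Touches : ∀ {n} → List (Multiset n) → Multiset n → Set
Touches L S = Any (λ F → S ⊆ₘ F) L

-- A connected layer multicomplex of rank d on the n-element set Fin n.
-- Layers are indexed (after shifting a to 0) by Fin (suc len), i.e. 0..len,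
-- so the length b - a is len.
record CLM (n d : ℕ) : Set where
  field
    len       : ℕ
    layer     : Fin (suc len) → List (Multiset n)
    rank      : ∀ i F → F ∈ layer i → size F ≡ d
    nonempty  : ∀ i → ∃ λ F → F ∈ layer i
    disjoint  : ∀ i j F → F ∈ layer i → F ∈ layer j → i ≡ j
    interval  : ∀ (S : Multiset n) (i j k : Fin (suc len)) →
                i Data.Fin.≤ j → j Data.Fin.≤ k →
                Touches (layer i) S → Touches (layer k) S → Touches (layer j) S

open CLM public

IsHclm : ℕ → ℕ → ℕ → Set
IsHclm n d h = (Σ (CLM n d) λ M → len M ≡ h) × (∀ (M : CLM n d) → len M Data.Nat.≤ h)

-- For every vertex u the layers containing u form an interval (the interval condition for S = {u}).
-- Cut the layers greedily into blocks s … t, where t is the last layer reached by a vertex v of layer s.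
-- Removing one copy of v from the facets of the block that contain v leaves a c.l.m. of rank d − 1 and
-- length t − s on the nᵢ vertices occurring in the block, so t − s ≤ H(nᵢ, d − 1); summing over the k
-- blocks bounds the length. A vertex occurring in a block and after the next block would occur in the
-- first layer of the next block and beyond its end, contradicting the choice of that end. So every vertex
-- is counted in at most two blocks, and a vertex of layer 0 only in the first one: Σ nᵢ ≤ 2n − 1.
-- That H(m, e) exists is a finiteness argument: the layers of a c.l.m. carry disjoint sets of multisets of
-- size e, and whether a c.l.m. of a given length exists is decidable by enumerating layers up to membership.
module Submission where

open import Defs
open import Data.Nat using (ℕ; zero; suc; _≤_; _<_; _+_; _*_; _∸_; z≤n; s≤s; _≤?_; _<?_; _≟_)
open import Data.Nat.Properties
open import Data.Nat.Induction using (<-wellFounded)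
open import Data.Nat.Tactic.RingSolver using (solve-∀)
open import Data.Fin as Fin using (Fin; zero; suc; toℕ; fromℕ<)
import Data.Fin.Properties as Finₚ
open import Data.Fin.Subset
  using (Subset; inside; outside; ∣_∣; ⁅_⁆; ∁)
  renaming (_∈_ to _∈ₛ_; _∉_ to _∉ₛ_; _⊆_ to _⊆ₛ_)
import Data.Fin.Subset.Properties as Subsetₚ
open import Data.Vec as Vec using (Vec; []; _∷_; sum; lookup; tabulate; zipWith; replicate)
import Data.Vec.Properties as Vecₚ
open import Data.List as List
  using (List; []; _∷_; [_]; _++_; map; filter; length; cartesianProductWith)
open import Data.List.Membership.Propositional using (_∈_; find; lose)
open import Data.List.Membership.Propositional.Properties
  using (∈-++⁺ˡ; ∈-++⁺ʳ; ∈-map⁺; ∈-map⁻; ∈-filter⁺; ∈-filter⁻; ∈-cartesianProductWith⁺; ∈-upTo⁺)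
open import Data.List.Relation.Unary.Any as Any using (Any; here)
import Data.List.Relation.Unary.Any.Properties as Anyₚ
open import Data.List.Relation.Unary.All as All using (All)
open import Data.Product using (Σ; _×_; _,_; proj₁; proj₂; ∃)
open import Data.Unit using (⊤; tt)
open import Data.Bool using (true; false)
open import Function using (_∘_; _⇔_; mk⇔; Equivalence)
import Function.Properties.Equivalence as ⇔
open import Induction.WellFounded using (Acc; acc)
open import Level using (0ℓ)
open import Relation.Binary.PropositionalEquality using (_≡_; refl; sym; trans; cong; cong₂; subst; subst₂)
open import Relation.Nullary using (Dec; yes; no; does; contradiction)
open import Relation.Nullary.Decidable using (dec-true; _×-dec_; _→-dec_; map′)
open import Relation.Unary using (Pred; Decidable)

private variable
  A : Set
  m n d e : ℕ

greatest : {P : ℕ → Set} → Decidable P → ∀ b → (∀ {h} → P h → h ≤ b) →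
           ∀ {s} → P s → Σ ℕ λ h → P h × (∀ {h′} → P h′ → h′ ≤ h)
greatest     P? zero    bounded ps = _ , ps , λ ph → ≤-trans (bounded ph) z≤n
greatest {P} P? (suc b) bounded ps with P? (suc b)
... | yes pb = suc b , pb , bounded
... | no ¬pb = greatest P? b (λ ph → m<1+n⇒m≤n (≤∧≢⇒< (bounded ph) λ eq → ¬pb (subst P eq ph))) ps

sublists : List A → List (List A)
sublists []       = [ [] ]
sublists (x ∷ xs) = map (x ∷_) (sublists xs) ++ sublists xs

filter∈sublists : {P : Pred A 0ℓ} (P? : Decidable P) (xs : List A) → filter P? xs ∈ sublists xs
filter∈sublists P? []       = here refl
filter∈sublists P? (x ∷ xs) with does (P? x)
... | true  = ∈-++⁺ˡ (∈-map⁺ (x ∷_) (filter∈sublists P? xs))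
... | false = ∈-++⁺ʳ _ (filter∈sublists P? xs)

vectors : List A → ∀ k → List (Vec A k)
vectors xs zero    = [ [] ]
vectors xs (suc k) = cartesianProductWith _∷_ xs (vectors xs k)

∈-vectors : {xs : List A} {v : Vec A m} → (∀ i → lookup v i ∈ xs) → v ∈ vectors xs m
∈-vectors {v = []}    _   = here refl
∈-vectors {v = x ∷ v} v⊆ = ∈-cartesianProductWith⁺ _∷_ (v⊆ zero) (∈-vectors (v⊆ ∘ suc))

_⊆?_ : (S F : Multiset n) → Dec (S ⊆ₘ F)
S ⊆? F = Finₚ.all? λ i → lookup S i ≤? lookup F i

touches? : (xs : List (Multiset n)) (S : Multiset n) → Dec (Touches xs S)
touches? xs S = Any.any? (S ⊆?_) xs

Touches-mono : {xs ys : List (Multiset n)} (S : Multiset n) →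
               (∀ {F} → F ∈ xs → F ∈ ys) → Touches xs S → Touches ys S
Touches-mono S xs⊆ys t = let F , F∈xs , S⊆F = find t in lose {P = S ⊆ₘ_} (xs⊆ys F∈xs) S⊆F

⊆ₘ-trans : {R S T : Multiset n} → R ⊆ₘ S → S ⊆ₘ T → R ⊆ₘ T
⊆ₘ-trans R⊆S S⊆T i = ≤-trans (R⊆S i) (S⊆T i)

lookup≤size : (F : Multiset n) (i : Fin n) → lookup F i ≤ size F
lookup≤size (x ∷ F) zero    = m≤m+n x (size F)
lookup≤size (x ∷ F) (suc i) = ≤-trans (lookup≤size F i) (m≤n+m (size F) x)

size-zeros : ∀ k → size (replicate k 0) ≡ 0
size-zeros zero    = refl
size-zeros (suc k) = size-zeros k

unit : Fin n → Multiset n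
unit zero    = 1 ∷ replicate _ 0
unit (suc u) = 0 ∷ unit u

size-unit : (u : Fin n) → size (unit u) ≡ 1
size-unit {suc n} zero    = cong suc (size-zeros n)
size-unit         (suc u) = size-unit u

unit⊆ : (F : Multiset n) (u : Fin n) → 1 ≤ lookup F u → unit u ⊆ₘ F
unit⊆ (x ∷ F) zero    1≤x zero    = 1≤x
unit⊆ (x ∷ F) zero    _   (suc i) = ≤-trans (≤-reflexive (Vecₚ.lookup-replicate i 0)) z≤n
unit⊆ (x ∷ F) (suc u) _   zero    = z≤n
unit⊆ (x ∷ F) (suc u) 1≤F (suc i) = unit⊆ F u 1≤F i

∃unit⊆ : (F : Multiset n) → size F ≡ suc d → ∃ λ u → unit u ⊆ₘ F
∃unit⊆ (zero  ∷ F) eq = let u , u⊆F = ∃unit⊆ F eq in suc u , λ { zero → z≤n ; (suc i) → u⊆F i }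
∃unit⊆ (suc x ∷ F) _  = zero , unit⊆ (suc x ∷ F) zero (s≤s z≤n)

infixl 30 _+ₘ_ _∸ₘ_
_+ₘ_ _∸ₘ_ : Multiset n → Multiset n → Multiset n
_+ₘ_ = zipWith _+_
_∸ₘ_ = zipWith _∸_

size-+ₘ : (S G : Multiset n) → size (S +ₘ G) ≡ size S + size G
size-+ₘ []      []      = refl
size-+ₘ (x ∷ S) (y ∷ G) = trans (cong (x + y +_) (size-+ₘ S G)) (interchange x y (size S) (size G))
  where open import Algebra.Properties.CommutativeSemigroup +-commutativeSemigroup using (interchange)

∸ₘ-+ₘ : {F G : Multiset n} → G ⊆ₘ F → (F ∸ₘ G) +ₘ G ≡ F
∸ₘ-+ₘ {F = []}    {[]}    _   = refl
∸ₘ-+ₘ {F = x ∷ F} {y ∷ G} G⊆F = cong₂ _∷_ (m∸n+n≡m (G⊆F zero)) (∸ₘ-+ₘ (G⊆F ∘ suc))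

size-∸ₘ : (F G : Multiset n) → G ⊆ₘ F → size (F ∸ₘ G) + size G ≡ size F
size-∸ₘ F G G⊆F = trans (sym (size-+ₘ (F ∸ₘ G) G)) (cong size (∸ₘ-+ₘ {F = F} G⊆F))

∸ₘ-injective : {F F′ G : Multiset n} → G ⊆ₘ F → G ⊆ₘ F′ → F ∸ₘ G ≡ F′ ∸ₘ G → F ≡ F′
∸ₘ-injective {F = F} {F′} {G} G⊆F G⊆F′ eq =
  trans (sym (∸ₘ-+ₘ G⊆F)) (trans (cong (_+ₘ G) eq) (∸ₘ-+ₘ G⊆F′))

∸ₘ⊆ : (F G : Multiset n) → F ∸ₘ G ⊆ₘ F
∸ₘ⊆ F G i = subst (_≤ lookup F i) (sym (Vecₚ.lookup-zipWith _∸_ i F G)) (m∸n≤m (lookup F i) (lookup G i))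

⊆∸ₘ⇔+ₘ⊆ : (S F G : Multiset n) → G ⊆ₘ F → S ⊆ₘ F ∸ₘ G ⇔ S +ₘ G ⊆ₘ F
⊆∸ₘ⇔+ₘ⊆ S F G G⊆F = mk⇔
  (λ S⊆F∸G i → subst (_≤ lookup F i) (sym (lookup-+ₘ i))
     (m≤o∸n⇒m+n≤o _ (G⊆F i) (subst (lookup S i ≤_) (lookup-∸ₘ i) (S⊆F∸G i))))
  (λ S+G⊆F i → subst (lookup S i ≤_) (sym (lookup-∸ₘ i))
     (m+n≤o⇒m≤o∸n _ (subst (_≤ lookup F i) (lookup-+ₘ i) (S+G⊆F i))))
  where
  lookup-+ₘ : ∀ i → lookup (S +ₘ G) i ≡ lookup S i + lookup G i
  lookup-+ₘ i = Vecₚ.lookup-zipWith _+_ i S G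
  lookup-∸ₘ : ∀ i → lookup (F ∸ₘ G) i ≡ lookup F i ∸ lookup G i
  lookup-∸ₘ i = Vecₚ.lookup-zipWith _∸_ i F G

+ₘ⊆⇒⊆ : (S F G : Multiset n) → S +ₘ G ⊆ₘ F → G ⊆ₘ F
+ₘ⊆⇒⊆ S F G S+G⊆F i =
  ≤-trans (m≤n+m _ (lookup S i)) (subst (_≤ lookup F i) (Vecₚ.lookup-zipWith _+_ i S G) (S+G⊆F i))

-- A c.l.m. whose layers are indexed by ℕ; only the layers 0 … top matter.
record CLM′ (n d : ℕ) : Set where
  field
    top        : ℕ
    L          : ℕ → List (Multiset n)
    L-rank     : ∀ {i F} → i ≤ top → F ∈ L i → size F ≡ d
    L-nonempty : ∀ {i} → i ≤ top → ∃ λ F → F ∈ L i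
    L-disjoint : ∀ {i j F} → i ≤ top → j ≤ top → F ∈ L i → F ∈ L j → i ≡ j
    L-interval : ∀ S {i j k} → i ≤ j → j ≤ k → k ≤ top →
                 Touches (L i) S → Touches (L k) S → Touches (L j) S

open CLM′

toCLM : CLM′ n d → CLM n d
toCLM M = record
  { len      = top M
  ; layer    = L M ∘ toℕ
  ; rank     = λ i F → L-rank M (Finₚ.toℕ≤pred[n] i)
  ; nonempty = λ i → L-nonempty M (Finₚ.toℕ≤pred[n] i)
  ; disjoint = λ i j F F∈i F∈j →
      Finₚ.toℕ-injective (L-disjoint M (Finₚ.toℕ≤pred[n] i) (Finₚ.toℕ≤pred[n] j) F∈i F∈j)
  ; interval = λ S i j k i≤j j≤k → L-interval M S i≤j j≤k (Finₚ.toℕ≤pred[n] k)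
  }

module _ (M : CLM n d) where

  layerℕ : ℕ → List (Multiset n)
  layerℕ i with i <? suc (len M)
  ... | yes i< = layer M (fromℕ< i<)
  ... | no  _  = []

  private
    index : ∀ {i} → i ≤ len M → Fin (suc (len M))
    index i≤ = fromℕ< (s≤s i≤)

    toℕ-index : ∀ {i} (i≤ : i ≤ len M) → toℕ (index i≤) ≡ i
    toℕ-index i≤ = Finₚ.toℕ-fromℕ< (s≤s i≤)

    index-mono : ∀ {i j} (i≤ : i ≤ len M) (j≤ : j ≤ len M) → i ≤ j → index i≤ Fin.≤ index j≤
    index-mono i≤ j≤ = subst₂ _≤_ (sym (toℕ-index i≤)) (sym (toℕ-index j≤))

    layerℕ-index : ∀ {i} (i≤ : i ≤ len M) → layerℕ i ≡ layer M (index i≤)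
    layerℕ-index {i} i≤ with i <? suc (len M)
    ... | yes _ = refl
    ... | no i≮ = contradiction (s≤s i≤) i≮

    ∈-index : ∀ {i F} (i≤ : i ≤ len M) → F ∈ layerℕ i → F ∈ layer M (index i≤)
    ∈-index i≤ = subst (_ ∈_) (layerℕ-index i≤)

    touches-index : ∀ {i} S (i≤ : i ≤ len M) → Touches (layerℕ i) S ⇔ Touches (layer M (index i≤)) S
    touches-index S i≤ = mk⇔ (subst (λ xs → Touches xs S) (layerℕ-index i≤))
                             (subst (λ xs → Touches xs S) (sym (layerℕ-index i≤)))

  fromCLM : CLM′ n d
  fromCLM = record
    { top        = len M
    ; L          = layerℕ
    ; L-rank     = λ i≤ F∈ → rank M _ _ (∈-index i≤ F∈)
    ; L-nonempty = λ i≤ → let F , F∈ = nonempty M (index i≤) in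
        F , subst (F ∈_) (sym (layerℕ-index i≤)) F∈
    ; L-disjoint = λ i≤ j≤ F∈i F∈j →
        trans (sym (toℕ-index i≤))
          (trans (cong toℕ (disjoint M _ _ _ (∈-index i≤ F∈i) (∈-index j≤ F∈j))) (toℕ-index j≤))
    ; L-interval = λ S i≤j j≤k k≤ ti tk →
        let j≤ = ≤-trans j≤k k≤ ; i≤ = ≤-trans i≤j j≤ in
        Equivalence.from (touches-index S j≤)
          (interval M S _ _ _ (index-mono i≤ j≤ i≤j) (index-mono j≤ k≤ j≤k)
            (Equivalence.to (touches-index S i≤) ti) (Equivalence.to (touches-index S k≤) tk))
    }

touches-map : {xs : List (Multiset m)} {f : Multiset m → Multiset n} {S : Multiset n} {T : Multiset m} →
              (∀ {F} → F ∈ xs → S ⊆ₘ f F ⇔ T ⊆ₘ F) → Touches (map f xs) S ⇔ Touches xs T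
touches-map {f = f} {S} S⊆f⇔T⊆ = mk⇔
  (λ t → let _ , fF∈ , S⊆fF = find t ; F , F∈ , eq = ∈-map⁻ f fF∈ in
         lose F∈ (Equivalence.to (S⊆f⇔T⊆ F∈) (subst (S ⊆ₘ_) eq S⊆fF)))
  (λ t → let F , F∈ , T⊆F = find t in lose (∈-map⁺ f F∈) (Equivalence.from (S⊆f⇔T⊆ F∈) T⊆F))

touches-filter : {P : Pred (Multiset n) 0ℓ} (P? : Decidable P) (xs : List (Multiset n)) (T : Multiset n) →
                 (∀ {F} → T ⊆ₘ F → P F) → Touches (filter P? xs) T ⇔ Touches xs T
touches-filter P? xs T T⊆⇒P = mk⇔
  (Touches-mono T (proj₁ ∘ ∈-filter⁻ P?))
  (λ t → let F , F∈ , T⊆F = find t in lose {P = T ⊆ₘ_} (∈-filter⁺ P? F∈ (T⊆⇒P T⊆F)) T⊆F)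

window : (M : CLM′ n d) {s t : ℕ} → s ≤ t → t ≤ top M → CLM′ n d
window M {s} {t} s≤t t≤ = record
  { top        = t ∸ s
  ; L          = λ j → L M (j + s)
  ; L-rank     = L-rank M ∘ shift
  ; L-nonempty = L-nonempty M ∘ shift
  ; L-disjoint = λ j≤ j′≤ F∈ F∈′ → +-cancelʳ-≡ s _ _ (L-disjoint M (shift j≤) (shift j′≤) F∈ F∈′)
  ; L-interval = λ S i≤j j≤k k≤ → L-interval M S (+-monoˡ-≤ s i≤j) (+-monoˡ-≤ s j≤k) (shift k≤)
  }
  where
  shift : ∀ {j} → j ≤ t ∸ s → j + s ≤ top M
  shift j≤ = ≤-trans (m≤o∸n⇒m+n≤o _ s≤t j≤) t≤

lk : Multiset n → List (Multiset n) → List (Multiset n)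
lk G xs = map (_∸ₘ G) (filter (G ⊆?_) xs)

∈-lk⁻ : (G : Multiset n) (xs : List (Multiset n)) {H : Multiset n} →
        H ∈ lk G xs → ∃ λ F → F ∈ xs × G ⊆ₘ F × H ≡ F ∸ₘ G
∈-lk⁻ G xs H∈ =
  let F , F∈ , H≡ = ∈-map⁻ _ H∈ ; F∈xs , G⊆F = ∈-filter⁻ (G ⊆?_) {xs = xs} F∈ in F , F∈xs , G⊆F , H≡

∈-lk⇒⊆ : (G : Multiset n) (xs : List (Multiset n)) {H : Multiset n} →
         H ∈ lk G xs → ∃ λ F → F ∈ xs × H ⊆ₘ F
∈-lk⇒⊆ G xs H∈ = let F , F∈ , _ , H≡ = ∈-lk⁻ G xs H∈ in
  F , F∈ , λ i → subst (λ H → lookup H i ≤ lookup F i) (sym H≡) (∸ₘ⊆ F G i)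

touches-lk : (G S : Multiset n) (xs : List (Multiset n)) → Touches (lk G xs) S ⇔ Touches xs (S +ₘ G)
touches-lk G S xs = ⇔.trans
  (touches-map {xs = filter (G ⊆?_) xs} {f = _∸ₘ G} {S} {S +ₘ G}
     λ {F} F∈ → ⊆∸ₘ⇔+ₘ⊆ S F G (proj₂ (∈-filter⁻ (G ⊆?_) {xs = xs} F∈)))
  (touches-filter (G ⊆?_) xs (S +ₘ G) λ {F} → +ₘ⊆⇒⊆ S F G)

link : (M : CLM′ n e) (G : Multiset n) → d + size G ≡ e → (∀ {i} → i ≤ top M → Touches (L M i) G) →
       CLM′ n d
link M G d+G≡e G∈ = record
  { top        = top M
  ; L          = λ i → lk G (L M i)
  ; L-rank     = λ {i} i≤ H∈ → let F , F∈ , G⊆F , H≡ = ∈-lk⁻ G (L M i) H∈ in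
      +-cancelʳ-≡ _ _ _ (trans (cong (λ H → size H + size G) H≡)
        (trans (size-∸ₘ F G G⊆F) (trans (L-rank M i≤ F∈) (sym d+G≡e))))
  ; L-nonempty = λ i≤ → let F , F∈ , G⊆F = find (G∈ i≤) in
      F ∸ₘ G , ∈-map⁺ _ (∈-filter⁺ (G ⊆?_) F∈ G⊆F)
  ; L-disjoint = λ {i} {j} i≤ j≤ H∈i H∈j →
      let F , F∈ , G⊆F , H≡ = ∈-lk⁻ G (L M i) H∈i ; F′ , F′∈ , G⊆F′ , H≡′ = ∈-lk⁻ G (L M j) H∈j
          F≡F′ = ∸ₘ-injective {F = F} {F′} {G} G⊆F G⊆F′ (trans (sym H≡) H≡′)
      in L-disjoint M i≤ j≤ F∈ (subst (_∈ L M j) (sym F≡F′) F′∈)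
  ; L-interval = λ S i≤j j≤k k≤ ti tk → Equivalence.from (touches-lk G S _)
      (L-interval M (S +ₘ G) i≤j j≤k k≤ (Equivalence.to (touches-lk G S _) ti)
                                        (Equivalence.to (touches-lk G S _) tk))
  }

SupportedOn : Subset n → Multiset n → Set
SupportedOn A F = ∀ u → u ∉ₛ A → lookup F u ≡ 0

proj : (A : Subset n) → Multiset n → Multiset ∣ A ∣
proj []            []      = []
proj (inside  ∷ A) (x ∷ F) = x ∷ proj A F
proj (outside ∷ A) (x ∷ F) = proj A F

pad : (A : Subset n) → Multiset ∣ A ∣ → Multiset n
pad []            []      = []
pad (inside  ∷ A) (x ∷ S) = x ∷ pad A S
pad (outside ∷ A) S       = 0 ∷ pad A S

private
  supported-tail : ∀ {b x} {A : Subset n} {F : Multiset n} → SupportedOn (b ∷ A) (x ∷ F) → SupportedOn A F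
  supported-tail F⊆A u u∉A = F⊆A (suc u) (u∉A ∘ Subsetₚ.drop-there)

size-proj : (A : Subset n) (F : Multiset n) → SupportedOn A F → size (proj A F) ≡ size F
size-proj []            []      _   = refl
size-proj (inside  ∷ A) (x ∷ F) F⊆A = cong (x +_) (size-proj A F (supported-tail F⊆A))
size-proj (outside ∷ A) (x ∷ F) F⊆A = cong₂ _+_ (sym (F⊆A zero λ ())) (size-proj A F (supported-tail F⊆A))

proj-injective : (A : Subset n) (F F′ : Multiset n) → SupportedOn A F → SupportedOn A F′ →
                 proj A F ≡ proj A F′ → F ≡ F′
proj-injective []            []      []        _   _    _  = refl
proj-injective (inside  ∷ A) (x ∷ F) (x′ ∷ F′) F⊆A F′⊆A eq =
  cong₂ _∷_ (Vecₚ.∷-injectiveˡ eq)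
    (proj-injective A F F′ (supported-tail F⊆A) (supported-tail F′⊆A) (Vecₚ.∷-injectiveʳ eq))
proj-injective (outside ∷ A) (x ∷ F) (x′ ∷ F′) F⊆A F′⊆A eq =
  cong₂ _∷_ (trans (F⊆A zero λ ()) (sym (F′⊆A zero λ ())))
    (proj-injective A F F′ (supported-tail F⊆A) (supported-tail F′⊆A) eq)

⊆proj⇔pad⊆ : (A : Subset n) (S : Multiset ∣ A ∣) (F : Multiset n) → S ⊆ₘ proj A F ⇔ pad A S ⊆ₘ F
⊆proj⇔pad⊆ A S F = mk⇔ (to A S F) (from A S F)
  where
  to : (A : Subset n) (S : Multiset ∣ A ∣) (F : Multiset n) → S ⊆ₘ proj A F → pad A S ⊆ₘ F
  to []            []      []      _  ()
  to (inside  ∷ A) (y ∷ S) (x ∷ F) S⊆ zero    = S⊆ zero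
  to (inside  ∷ A) (y ∷ S) (x ∷ F) S⊆ (suc i) = to A S F (S⊆ ∘ suc) i
  to (outside ∷ A) S       (x ∷ F) _  zero    = z≤n
  to (outside ∷ A) S       (x ∷ F) S⊆ (suc i) = to A S F S⊆ i
  from : (A : Subset n) (S : Multiset ∣ A ∣) (F : Multiset n) → pad A S ⊆ₘ F → S ⊆ₘ proj A F
  from (inside  ∷ A) (y ∷ S) (x ∷ F) S⊆ zero    = S⊆ zero
  from (inside  ∷ A) (y ∷ S) (x ∷ F) S⊆ (suc i) = from A S F (S⊆ ∘ suc) i
  from (outside ∷ A) S       (x ∷ F) S⊆ i       = from A S F (S⊆ ∘ suc) i

restrict : (M : CLM′ n d) (A : Subset n) → (∀ {i F} → i ≤ top M → F ∈ L M i → SupportedOn A F) →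
           CLM′ ∣ A ∣ d
restrict M A supported = record
  { top        = top M
  ; L          = λ i → map (proj A) (L M i)
  ; L-rank     = λ i≤ H∈ → let F , F∈ , H≡ = ∈-map⁻ (proj A) H∈ in
      trans (cong size H≡) (trans (size-proj A F (supported i≤ F∈)) (L-rank M i≤ F∈))
  ; L-nonempty = λ i≤ → let F , F∈ = L-nonempty M i≤ in proj A F , ∈-map⁺ (proj A) F∈
  ; L-disjoint = λ {i} {j} i≤ j≤ H∈i H∈j →
      let F , F∈ , H≡ = ∈-map⁻ (proj A) H∈i ; F′ , F′∈ , H≡′ = ∈-map⁻ (proj A) H∈j
          F≡F′ = proj-injective A F F′ (supported i≤ F∈) (supported j≤ F′∈) (trans (sym H≡) H≡′)
      in L-disjoint M i≤ j≤ F∈ (subst (_∈ L M j) (sym F≡F′) F′∈)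
  ; L-interval = λ S i≤j j≤k k≤ ti tk → Equivalence.from (touches-proj S)
      (L-interval M (pad A S) i≤j j≤k k≤ (Equivalence.to (touches-proj S) ti)
                                         (Equivalence.to (touches-proj S) tk))
  }
  where
  touches-proj : ∀ {i} S → Touches (map (proj A) (L M i)) S ⇔ Touches (L M i) (pad A S)
  touches-proj {i} S = touches-map {xs = L M i} {f = proj A} {S} {pad A S} λ {F} _ → ⊆proj⇔pad⊆ A S F

singleton : (F : Multiset n) → CLM n (size F)
singleton F = record
  { len      = 0
  ; layer    = λ _ → [ F ]
  ; rank     = λ { _ _ (here refl) → refl }
  ; nonempty = λ _ → F , here refl
  ; disjoint = λ { zero zero _ _ _ → refl }
  ; interval = λ { _ zero zero zero _ _ t _ → t }
  }

module Finiteness (m e : ℕ) where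

  open import Data.List.Membership.DecPropositional (Vecₚ.≡-dec {n = m} _≟_) using (_∈?_)

  bounded : List (Multiset m)
  bounded = vectors (List.upTo (suc e)) m

  ∈-bounded : (S : Multiset m) → (∀ i → lookup S i ≤ e) → S ∈ bounded
  ∈-bounded S S≤e = ∈-vectors (λ i → ∈-upTo⁺ (s≤s (S≤e i)))

  facets : List (Multiset m)
  facets = filter (λ F → size F ≟ e) bounded

  ∈-facets : (F : Multiset m) → size F ≡ e → F ∈ facets
  ∈-facets F eq = ∈-filter⁺ _ (∈-bounded F (λ i → subst (lookup F i ≤_) eq (lookup≤size F i))) eq

  -- The interval condition is only imposed on the multisets in `bounded`: no other multiset lies in a facet.
  IsCLM : ∀ {h} → (Fin (suc h) → List (Multiset m)) → Set
  IsCLM lay = (∀ i → All (λ F → size F ≡ e) (lay i))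
            × (∀ i → Any (λ _ → ⊤) (lay i))
            × (∀ i j → All (λ F → F ∈ lay j → i ≡ j) (lay i))
            × All (λ S → ∀ i j k → i Fin.≤ j → j Fin.≤ k →
                         Touches (lay i) S → Touches (lay k) S → Touches (lay j) S) bounded

  isCLM? : ∀ {h} (lay : Fin (suc h) → List (Multiset m)) → Dec (IsCLM lay)
  isCLM? lay =
          Finₚ.all? (λ i → All.all? (λ F → size F ≟ e) (lay i))
    ×-dec Finₚ.all? (λ i → Any.any? (λ _ → yes tt) (lay i))
    ×-dec Finₚ.all? (λ i → Finₚ.all? λ j → All.all? (λ F → (F ∈? lay j) →-dec (i Fin.≟ j)) (lay i))
    ×-dec All.all? (λ S → Finₚ.all? λ i → Finₚ.all? λ j → Finₚ.all? λ k →
            (i Finₚ.≤? j) →-dec (j Finₚ.≤? k) →-dec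
            touches? (lay i) S →-dec touches? (lay k) S →-dec touches? (lay j) S) bounded

  fromIsCLM : ∀ {h} (lay : Fin (suc h) → List (Multiset m)) → IsCLM lay → CLM m e
  fromIsCLM {h} lay (ranked , inhabited , separate , intervals) = record
    { len      = h
    ; layer    = lay
    ; rank     = λ i F → All.lookup (ranked i)
    ; nonempty = λ i → let F , F∈ , _ = find (inhabited i) in F , F∈
    ; disjoint = λ i j F → All.lookup (separate i j)
    ; interval = λ S i j k i≤j j≤k ti tk →
        let F , F∈ , S⊆F = find ti
            S≤e x = ≤-trans (S⊆F x) (subst (lookup F x ≤_) (All.lookup (ranked i) F∈) (lookup≤size F x))
        in All.lookup intervals (∈-bounded S S≤e) i j k i≤j j≤k ti tk
    }

  isCLM-layer : (M : CLM m e) (lay : Fin (suc (len M)) → List (Multiset m)) →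
                (∀ i {F} → F ∈ lay i ⇔ F ∈ layer M i) → IsCLM lay
  isCLM-layer M lay same =
      (λ i → All.tabulate λ F∈ → rank M i _ (to i F∈))
    , (λ i → lose (from i (proj₂ (nonempty M i))) tt)
    , (λ i j → All.tabulate λ F∈i F∈j → disjoint M i j _ (to i F∈i) (to j F∈j))
    , All.tabulate λ {S} _ i j k i≤j j≤k ti tk → Touches-mono S (from j)
        (interval M S i j k i≤j j≤k (Touches-mono S (to i) ti) (Touches-mono S (to k) tk))
    where
    to : ∀ i {F} → F ∈ lay i → F ∈ layer M i
    to i = Equivalence.to (same i)
    from : ∀ i {F} → F ∈ layer M i → F ∈ lay i
    from i = Equivalence.from (same i)

  HasLength : ℕ → Set
  HasLength h = Σ (CLM m e) λ M → len M ≡ h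

  -- Every c.l.m. has the same layers, up to membership, as one of these candidates.
  candidates : ∀ h → List (Vec (List (Multiset m)) (suc h))
  candidates h = vectors (sublists facets) (suc h)

  candidate-of : (M : CLM m e) → Any (IsCLM ∘ lookup) (candidates (len M))
  candidate-of M = lose {P = IsCLM ∘ lookup} {x = lay}
    (∈-vectors λ i → subst (_∈ sublists facets) (sym (lay≡ i)) (filter∈sublists _ facets))
    (isCLM-layer M (lookup lay) same)
    where
    lay : Vec (List (Multiset m)) (suc (len M))
    lay = tabulate λ i → filter (_∈? layer M i) facets
    lay≡ : ∀ i → lookup lay i ≡ filter (_∈? layer M i) facets
    lay≡ = Vecₚ.lookup∘tabulate _
    same : ∀ i {F} → F ∈ lookup lay i ⇔ F ∈ layer M i
    same i {F} rewrite lay≡ i =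
      mk⇔ (proj₂ ∘ ∈-filter⁻ (_∈? layer M i) {xs = facets})
          (λ F∈ → ∈-filter⁺ (_∈? layer M i) (∈-facets F (rank M i F F∈)) F∈)

  hasLength? : ∀ h → Dec (HasLength h)
  hasLength? h = map′
    (λ c → let lay , _ , valid = find c in fromIsCLM (lookup lay) valid , refl)
    (λ (M , eq) → subst (λ h → Any (IsCLM ∘ lookup) (candidates h)) eq (candidate-of M))
    (Any.any? (isCLM? ∘ lookup) (candidates h))

  len<facets : (M : CLM m e) → len M < length facets
  len<facets M = Finₚ.injective⇒≤ {f = position} position-injective
    where
    facet : Fin (suc (len M)) → Multiset m
    facet i = proj₁ (nonempty M i)
    facet∈ : ∀ i → facet i ∈ layer M i
    facet∈ i = proj₂ (nonempty M i)
    facet∈facets : ∀ i → facet i ∈ facets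
    facet∈facets i = ∈-facets (facet i) (rank M i _ (facet∈ i))
    position : Fin (suc (len M)) → Fin (length facets)
    position i = Any.index (facet∈facets i)
    position-injective : ∀ {i j} → position i ≡ position j → i ≡ j
    position-injective {i} {j} eq =
      disjoint M i j (facet i) (facet∈ i) (subst (_∈ layer M j) facet≡ (facet∈ j))
      where
      facet≡ : facet j ≡ facet i
      facet≡ = trans (Anyₚ.lookup-index (facet∈facets j))
                 (trans (cong (List.lookup facets) (sym eq)) (sym (Anyₚ.lookup-index (facet∈facets i))))

Hclm-exists : ∀ m e → 1 ≤ m → Σ ℕ (IsHclm m e)
Hclm-exists (suc m) e _ =
  let h , has-h , maximal = greatest hasLength? (length facets)
                              (λ (M , eq) → subst (_≤ _) eq (<⇒≤ (len<facets M))) (witness , refl)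
  in h , has-h , λ M → maximal (M , refl)
  where
  open Finiteness (suc m) e
  witness : CLM (suc m) e
  witness = subst (CLM (suc m)) (trans (cong (e +_) (size-zeros m)) (+-identityʳ e))
                  (singleton (e ∷ replicate m 0))

⟦_⟧ : {P : Pred (Fin n) 0ℓ} → Decidable P → Subset n
⟦ P? ⟧ = tabulate (does ∘ P?)

∈⟦⟧⁺ : {P : Pred (Fin n) 0ℓ} (P? : Decidable P) {u : Fin n} → P u → u ∈ₛ ⟦ P? ⟧
∈⟦⟧⁺ P? {u} pu = Vecₚ.lookup⇒[]= u _ (trans (Vecₚ.lookup∘tabulate _ u) (dec-true (P? u) pu))

∈⟦⟧⁻ : {P : Pred (Fin n) 0ℓ} (P? : Decidable P) {u : Fin n} → u ∈ₛ ⟦ P? ⟧ → P u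
∈⟦⟧⁻ P? {u} u∈ = witness (P? u) (trans (sym (Vecₚ.lookup∘tabulate _ u)) (Vecₚ.[]=⇒lookup u∈))
  where
  witness : {A : Set} (a? : Dec A) → does a? ≡ true → A
  witness (yes a) _  = a
  witness (no _)  ()

disjoint⇒∣p∣+∣q∣≤∣r∣ : {p q r : Subset n} → p ⊆ₛ r → q ⊆ₛ r → (∀ {u} → u ∈ₛ p → u ∉ₛ q) →
                       ∣ p ∣ + ∣ q ∣ ≤ ∣ r ∣

private
  tails : ∀ {a b c} {p q r : Subset n} → a ∷ p ⊆ₛ c ∷ r → b ∷ q ⊆ₛ c ∷ r →
          (∀ {u} → u ∈ₛ a ∷ p → u ∉ₛ b ∷ q) → ∣ p ∣ + ∣ q ∣ ≤ ∣ r ∣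

disjoint⇒∣p∣+∣q∣≤∣r∣ {p = []}          {[]}          {[]}          _   _   _  = z≤n
disjoint⇒∣p∣+∣q∣≤∣r∣ {p = inside  ∷ p} {inside  ∷ q} {r}           _   _   pq =
  contradiction Vec.here (pq Vec.here)
disjoint⇒∣p∣+∣q∣≤∣r∣ {p = inside  ∷ p} {outside ∷ q} {outside ∷ r} p⊆r _   _  =
  contradiction (p⊆r Vec.here) λ ()
disjoint⇒∣p∣+∣q∣≤∣r∣ {p = outside ∷ p} {inside  ∷ q} {outside ∷ r} _   q⊆r _  =
  contradiction (q⊆r Vec.here) λ ()
disjoint⇒∣p∣+∣q∣≤∣r∣ {p = inside  ∷ p} {outside ∷ q} {inside  ∷ r} p⊆r q⊆r pq =
  s≤s (tails p⊆r q⊆r pq)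
disjoint⇒∣p∣+∣q∣≤∣r∣ {p = outside ∷ p} {inside  ∷ q} {inside  ∷ r} p⊆r q⊆r pq =
  subst (_≤ suc ∣ r ∣) (sym (+-suc ∣ p ∣ ∣ q ∣)) (s≤s (tails p⊆r q⊆r pq))
disjoint⇒∣p∣+∣q∣≤∣r∣ {p = outside ∷ p} {outside ∷ q} {x ∷ r}       p⊆r q⊆r pq =
  ≤-trans (tails p⊆r q⊆r pq) (Subsetₚ.∣p∣≤∣x∷p∣ x r)

tails p⊆r q⊆r pq = disjoint⇒∣p∣+∣q∣≤∣r∣ (Subsetₚ.drop-∷-⊆ p⊆r) (Subsetₚ.drop-∷-⊆ q⊆r)
                     λ u∈p u∈q → pq (Vec.there u∈p) (Vec.there u∈q)

covers-step : ∀ {ℓ t} s h H k → t ≤ s + h → suc ℓ ≤ suc t + (H + k) → suc ℓ ≤ s + ((h + H) + suc k)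
covers-step s h H k t≤s+h ℓ< =
  ≤-trans ℓ< (≤-trans (+-monoˡ-≤ (H + k) (s≤s t≤s+h)) (≤-reflexive (rearrange s h H k)))
  where
  rearrange : ∀ s h H k → suc (s + h) + (H + k) ≡ s + ((h + H) + suc k)
  rearrange = solve-∀

counted-step : ∀ {a b c x y} → a + c ≤ x → y ≤ b + c → a + y ≤ x + b
counted-step {a} {b} {c} a+c≤x y≤b+c =
  ≤-trans (+-monoʳ-≤ a y≤b+c) (≤-trans (≤-reflexive (rearrange a b c)) (+-monoˡ-≤ b a+c≤x))
  where
  rearrange : ∀ a b c → a + (b + c) ≡ (a + c) + b
  rearrange = solve-∀

module Blocks {n d : ℕ} (M : CLM′ n (suc d)) where

  Appears : Fin n → ℕ → Set
  Appears u i = i ≤ top M × Touches (L M i) (unit u)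

  appears? : ∀ u i → Dec (Appears u i)
  appears? u i = (i ≤? top M) ×-dec touches? (L M i) (unit u)

  appears-between : ∀ {u i j k} → i ≤ j → j ≤ k → Appears u i → Appears u k → Appears u j
  appears-between {u} i≤j j≤k (_ , ti) (k≤ , tk) = ≤-trans j≤k k≤ , L-interval M (unit u) i≤j j≤k k≤ ti tk

  some-appears : ∀ {i} → i ≤ top M → ∃ λ u → Appears u i
  some-appears i≤ = let F , F∈ = L-nonempty M i≤ ; u , u⊆F = ∃unit⊆ F (L-rank M i≤ F∈) in
    u , i≤ , lose F∈ u⊆F

  Occurs : ℕ → ℕ → Fin n → Set
  Occurs s t u = ∃ λ r → r < suc t × s ≤ r × Touches (L M r) (unit u)

  occurs? : ∀ s t → Decidable (Occurs s t)
  occurs? s t u = anyUpTo? (λ r → (s ≤? r) ×-dec touches? (L M r) (unit u)) (suc t)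

  verticesIn : ℕ → ℕ → Subset n
  verticesIn s t = ⟦ occurs? s t ⟧

  verticesFrom : ℕ → Subset n
  verticesFrom s = verticesIn s (top M)

  verticesIn-mono : ∀ {s s′ t t′} → s ≤ s′ → t′ ≤ t → verticesIn s′ t′ ⊆ₛ verticesIn s t
  verticesIn-mono s≤s′ t′≤t u∈ = let r , r< , s′≤r , tr = ∈⟦⟧⁻ (occurs? _ _) u∈ in
    ∈⟦⟧⁺ (occurs? _ _) (r , ≤-trans r< (s≤s t′≤t) , ≤-trans s≤s′ s′≤r , tr)

  verticesIn⊆verticesFrom : ∀ s {t} → t ≤ top M → verticesIn s t ⊆ₛ verticesFrom s
  verticesIn⊆verticesFrom s = verticesIn-mono (≤-refl {s})

  verticesFrom-mono : ∀ {s s′} → s ≤ s′ → verticesFrom s′ ⊆ₛ verticesFrom s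
  verticesFrom-mono s≤s′ = verticesIn-mono s≤s′ (≤-refl {top M})

  appears-in : ∀ s t {u} → t ≤ top M → u ∈ₛ verticesIn s t → ∃ λ r → s ≤ r × r ≤ t × Appears u r
  appears-in s t t≤ u∈ = let r , r< , s≤r , tr = ∈⟦⟧⁻ (occurs? s t) u∈ in
    r , s≤r , m<1+n⇒m≤n r< , ≤-trans (m<1+n⇒m≤n r<) t≤ , tr

  Spans : ℕ → ℕ → Set
  Spans s t = ∃ λ u → Appears u s × Appears u t

  module Block {s} (s≤ : s ≤ top M) where

    private
      greatest-span : Σ ℕ λ t → Spans s t × (∀ {t′} → Spans s t′ → t′ ≤ t)
      greatest-span = let u , a = some-appears s≤ in
        greatest (λ t → Finₚ.any? λ u → appears? u s ×-dec appears? u t) (top M)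
                 (λ span → proj₁ (proj₂ (proj₂ span))) (u , a , a)

    t : ℕ
    t = proj₁ greatest-span

    v : Fin n
    v = proj₁ (proj₁ (proj₂ greatest-span))

    v-s : Appears v s
    v-s = proj₁ (proj₂ (proj₁ (proj₂ greatest-span)))

    v-t : Appears v t
    v-t = proj₂ (proj₂ (proj₁ (proj₂ greatest-span)))

    spans≤t : ∀ {t′} → Spans s t′ → t′ ≤ t
    spans≤t = proj₂ (proj₂ greatest-span)

    s≤t : s ≤ t
    s≤t = spans≤t (v , v-s , v-s)

    t≤ : t ≤ top M
    t≤ = proj₁ v-t

    separated : ∀ {u} → Appears u s → u ∉ₛ verticesFrom (suc t)
    separated {u} a u∈ = let r , t<r , _ , ar = appears-in (suc t) (top M) ≤-refl u∈ in
      <⇒≱ t<r (spans≤t (u , a , ar))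

    vertexLink : CLM′ n d
    vertexLink = link (window M s≤t t≤) (unit v) (trans (cong (d +_) (size-unit v)) (+-comm d 1))
      λ {j} j≤ → proj₂ (appears-between {u = v} (m≤n+m s j) (m≤o∸n⇒m+n≤o j s≤t j≤) v-s v-t)

    supported : ∀ {j G} → j ≤ t ∸ s → G ∈ L vertexLink j → SupportedOn (verticesIn s t) G
    supported {j} {G} j≤ G∈ u u∉ with lookup G u in G[u]
    ... | zero  = refl
    ... | suc _ =
      let F , F∈ , G⊆F = ∈-lk⇒⊆ (unit v) (L M (j + s)) G∈
          u⊆G = unit⊆ G u (subst (1 ≤_) (sym G[u]) (s≤s z≤n))
          u-occurs = j + s , s≤s (m≤o∸n⇒m+n≤o j s≤t j≤) , m≤n+m s j ,
                     lose F∈ (⊆ₘ-trans {R = unit u} {G} {F} u⊆G G⊆F)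
      in contradiction (∈⟦⟧⁺ (occurs? s t) u-occurs) u∉

    blockCLM : CLM′ ∣ verticesIn s t ∣ d
    blockCLM = restrict vertexLink (verticesIn s t) supported

    ∣verticesIn∣-positive : 1 ≤ ∣ verticesIn s t ∣
    ∣verticesIn∣-positive = ≤-trans (s≤s z≤n)
      (Subsetₚ.x∈p⇒∣p-x∣<∣p∣ {x = v} (∈⟦⟧⁺ (occurs? s t) (s , s≤s s≤t , ≤-refl , proj₂ v-s)))

    H : Σ ℕ (IsHclm ∣ verticesIn s t ∣ d)
    H = Hclm-exists _ d ∣verticesIn∣-positive

    t≤s+H : t ≤ s + proj₁ H
    t≤s+H = ≤-trans (m≤n+m∸n t s) (+-monoʳ-≤ s (proj₂ (proj₂ H) (toCLM blockCLM)))

  record Decomposition {s} (s≤ : s ≤ top M) : Set where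
    field
      k       : ℕ
      ns hs   : Vec ℕ k
      ns-pos  : ∀ i → 1 ≤ lookup ns i
      hs-H    : ∀ i → IsHclm (lookup ns i) d (lookup hs i)
      covers  : suc (top M) ≤ s + (sum hs + k)
      counted : sum ns ≤ ∣ verticesFrom s ∣ + ∣ verticesFrom (suc (Block.t s≤)) ∣

  decompose : ∀ {s} (s≤ : s ≤ top M) → Acc _<_ (top M ∸ s) → Decomposition s≤
  decompose {s} s≤ (acc smaller) with suc (Block.t s≤) ≤? top M
  ... | no t≮ = record
    { k       = 1
    ; ns      = ∣ verticesIn s t ∣ ∷ []
    ; hs      = proj₁ H ∷ []
    ; ns-pos  = λ { zero → ∣verticesIn∣-positive }
    ; hs-H    = λ { zero → proj₂ H }
    ; covers  = covers-step s (proj₁ H) 0 0 t≤s+H (≤-trans (s≤s (≮⇒≥ t≮)) (m≤m+n _ 0))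
    ; counted = ≤-trans (≤-reflexive (+-identityʳ _))
                  (≤-trans (Subsetₚ.p⊆q⇒∣p∣≤∣q∣ (verticesIn⊆verticesFrom s t≤)) (m≤m+n _ _))
    }
    where open Block s≤
  ... | yes t< = record
    { k       = suc k
    ; ns      = ∣ verticesIn s t ∣ ∷ ns
    ; hs      = proj₁ H ∷ hs
    ; ns-pos  = λ { zero → ∣verticesIn∣-positive ; (suc i) → ns-pos i }
    ; hs-H    = λ { zero → proj₂ H ; (suc i) → hs-H i }
    ; covers  = covers-step s (proj₁ H) (sum hs) k t≤s+H covers
    ; counted = counted-step
        (disjoint⇒∣p∣+∣q∣≤∣r∣ (verticesIn⊆verticesFrom s t≤) (verticesFrom-mono s≤next) fresh) counted
    }
    where
    open Block s≤
    open Decomposition (decompose t< (smaller (∸-monoʳ-< (s≤s s≤t) t<)))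
    next : ℕ
    next = suc (Block.t t<)
    suc-t≤next : suc t ≤ next
    suc-t≤next = ≤-trans (Block.s≤t t<) (n≤1+n _)
    s≤next : s ≤ next
    s≤next = ≤-trans s≤t (≤-trans (n≤1+n t) suc-t≤next)
    fresh : ∀ {u} → u ∈ₛ verticesIn s t → u ∉ₛ verticesFrom next
    fresh {u} u∈block u∈later =
      let r , _ , r≤t , ar = appears-in s t t≤ u∈block
          r′ , next≤r′ , _ , ar′ = appears-in next (top M) ≤-refl u∈later
          a = appears-between {u} (≤-trans r≤t (n≤1+n t)) (≤-trans suc-t≤next next≤r′) ar ar′
      in Block.separated t< a u∈later

  ∣verticesFrom∣≤2n∸1 : 1 ≤ n → ∣ verticesFrom 0 ∣ + ∣ verticesFrom (suc (Block.t z≤n)) ∣ ≤ 2 * n ∸ 1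
  ∣verticesFrom∣≤2n∸1 1≤n = begin
    ∣ verticesFrom 0 ∣ + ∣ verticesFrom next ∣
      ≤⟨ +-mono-≤ (Subsetₚ.∣p∣≤n (verticesFrom 0)) (Subsetₚ.p⊆q⇒∣p∣≤∣q∣ later⊆∁u₀) ⟩
    n + ∣ ∁ ⁅ u₀ ⁆ ∣
      ≡⟨ cong (n +_) (trans (Subsetₚ.∣∁p∣≡n∸∣p∣ ⁅ u₀ ⁆) (cong (n ∸_) (Subsetₚ.∣⁅x⁆∣≡1 u₀))) ⟩
    n + (n ∸ 1)
      ≡⟨ +-∸-assoc n 1≤n ⟨
    (n + n) ∸ 1
      ≡⟨ cong (λ m → (n + m) ∸ 1) (+-identityʳ n) ⟨
    2 * n ∸ 1
      ∎
    where
    open ≤-Reasoning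
    next : ℕ
    next = suc (Block.t z≤n)
    u₀ : Fin n
    u₀ = proj₁ (some-appears z≤n)
    later⊆∁u₀ : verticesFrom next ⊆ₛ ∁ ⁅ u₀ ⁆
    later⊆∁u₀ u∈ = Subsetₚ.x∉p⇒x∈∁p λ u∈⁅u₀⁆ → Block.separated z≤n (proj₂ (some-appears z≤n))
      (subst (_∈ₛ verticesFrom next) (Subsetₚ.x∈⁅y⁆⇒x≡y u₀ u∈⁅u₀⁆) u∈)

lemma3p13 : (d n : ℕ) → 1 ≤ d → 1 ≤ n → (M : CLM n d) →
    Σ ℕ λ k → Σ (Vec ℕ k) λ ns → Σ (Vec ℕ k) λ hs →
    (∀ i → 1 ≤ lookup ns i) × (sum ns ≤ 2 * n ∸ 1) ×
    (∀ i → IsHclm (lookup ns i) (d ∸ 1) (lookup hs i)) ×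
    (len M + 1 ≤ sum hs + k)
lemma3p13 zero    _ ()  _   _
lemma3p13 (suc d) n _ 1≤n M =
  k , ns , hs , ns-pos , ≤-trans counted (∣verticesFrom∣≤2n∸1 1≤n) , hs-H ,
  subst (_≤ sum hs + k) (+-comm 1 (len M)) covers
  where
  open Blocks (fromCLM M)
  open Decomposition (decompose z≤n (<-wellFounded _))
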